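{- Let $k\ge 3$, $3<n\le k$, and $f\in P_k^n$. Then the following are equivalent: (i) $f\in G_{2,k}^{n,- }$; (ii) $f=t\oplus g$, where $g\in G_{n,k}^n$ with $g_{i\leftarrow j}=0$ for all $1\le i,j\le n$, $i\neq j$, and $t\in P_k^n$ is a totally symmetric function with $Ess(t_{i\leftarrow j})=\{x_1,\ldots,x_n\}\setminus\{x_i,x_j\}$ for all $i,j\in\{1,\ldots,n\}$, $i\neq j$.
   Context: $K=\{0,1,\ldots,k-1\}$ is the ring of residues modulo $k$, $\oplus$ is pointwise addition modulo $k$. $P_k^n$ is the set of all functions $K^n\to K$ in variables $x_1,\ldots,x_n$. A function is totally symmetric if it is invariant under every permutation of its arguments. A variable $x_i$ is essential in $g$ if changing only the $i$-th argument can change the value of $g$; $Ess(g)$ is the set of essential variables, $ess(g)=|Ess(g)|$. For $i\neq j$, $g_{i\leftarrow j}(a_1,\ldots,a_n)=g(a_1,\ldots,a_{i-1},a_j,a_{i+1},\ldots,a_n)$. $Min(g)$ is the set of all $g_{i\leftarrow j}$ with $i\neq j$ and $x_i,x_j\in Ess(g)$; $gap(g)=ess(g)-\max_{s\in Min(g)}ess(s)$. $G_{p,k}^m=\{f\in P_k^n: ess(f)=m,\ gap(f)=p\}$. $G_{p,k}^{n,- }$ is the set of $f\in G_{p,k}^n$ such that $x_v\notin Ess(f_{u\leftarrow v})$ for all $u\neq v$ in $\{1,\ldots,n\}$. -}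

module Defs where

open import Data.Nat using (ℕ; zero; suc; _+_; _∸_; _≤_)
open import Data.Nat.DivMod using (_%_; m%n<n)
open import Data.Fin using (Fin; toℕ; fromℕ<)
open import Data.Fin.Subset using (Subset; _∈_; ∣_∣)
open import Data.Fin.Permutation using (Permutation′; _⟨$⟩ʳ_)
open import Data.Vec using (Vec; lookup; tabulate; _[_]≔_)
open import Data.Product using (Σ; ∃; ∃-syntax; _×_; _,_)
open import Relation.Binary.PropositionalEquality using (_≡_; _≢_)
open import Relation.Nullary using (¬_)
open import Function.Bundles using (_⇔_)

-- K = Fin k ; an n-ary function K^n → K (element of P_k^n)
Op : ℕ → ℕ → Set
Op k n = Vec (Fin k) n → Fin k

_⊕K_ : ∀ {k} → Fin k → Fin k → Fin k
_⊕K_ {suc k} a b = fromℕ< (m%n<n (toℕ a + toℕ b) (suc k))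

_⊕_ : ∀ {k n} → Op k n → Op k n → Op k n
(t ⊕ g) a = t a ⊕K g a

Essential : ∀ {k n} → Op k n → Fin n → Set
Essential g i = ∃[ a ] ∃[ c ] g a ≢ g (a [ i ]≔ c)

EssCount : ∀ {k n} → Op k n → ℕ → Set
EssCount {n = n} g m =
  Σ (Subset n) λ S → (∀ i → (i ∈ S) ⇔ Essential g i) × ∣ S ∣ ≡ m

ident : ∀ {k n} → Op k n → Fin n → Fin n → Op k n
ident g i j a = g (a [ i ]≔ lookup a j)

-- max_{s ∈ Min(g)} ess(s) ≡ m
MaxMinEss : ∀ {k n} → Op k n → ℕ → Set
MaxMinEss g m =
  (∃[ i ] ∃[ j ] (i ≢ j × Essential g i × Essential g j × EssCount (ident g i j) m))
  × (∀ i j → i ≢ j → Essential g i → Essential g j →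
       ∀ m′ → EssCount (ident g i j) m′ → m′ ≤ m)

Gap : ∀ {k n} → Op k n → ℕ → Set
Gap g p = ∃[ m ] ∃[ m′ ] (EssCount g m × MaxMinEss g m′ × p ≡ m ∸ m′)

InG : ∀ {k n} → ℕ → ℕ → Op k n → Set
InG p m g = EssCount g m × Gap g p

InGminus : ∀ {k n} → ℕ → Op k n → Set
InGminus {n = n} p f =
  InG p n f × (∀ (u v : Fin n) → u ≢ v → ¬ Essential (ident f u v) v)

TotSym : ∀ {k n} → Op k n → Set
TotSym {n = n} t =
  ∀ (π : Permutation′ n) (a : Vec _ n) → t a ≡ t (tabulate (λ l → lookup a (π ⟨$⟩ʳ l)))

-- The hypothesis x_v ∉ Ess(f_{u←v}) says that on the diagonal x_u = x_v the common value of the two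
-- coordinates can be changed without changing f. Chaining such moves realises every transposition,
-- hence every permutation, of a vector with a repeated entry: f is totally symmetric on such vectors.
-- Permutations therefore transport the essential variables of one identification f_{i←j} to any other,
-- and gap 2 yields one pair with Ess(f_{i←j}) = {x_l : l ≠ i, j}, hence all pairs do. Now let t agree
-- with f on vectors with a repeated entry and be a constant c elsewhere, and put g = f ⊖ t. Then g
-- vanishes on every identification, while choosing c ≠ f(d) for a vector d with distinct entries
-- (possible as n ≤ k) makes all variables of g essential. Conversely, g_{i←j} = 0 gives f_{i←j} = t_{i←j},
-- from which the essential variables and the gap of f are read off directly.
module Submission where

open import Defs
open import Data.Nat using (ℕ; _≤_; _<_)
open import Data.Fin using (Fin; toℕ)
open import Data.Vec using (Vec)
open import Data.Product using (Σ; ∃; ∃-syntax; _×_)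
open import Relation.Binary.PropositionalEquality using (_≡_; _≢_)
open import Function.Bundles using (_⇔_)

open import Algebra.Properties.CommutativeSemigroup using (x∙yz≈y∙xz)
open import Data.Bool using (if_then_else_)
open import Data.Fin using (zero; suc; fromℕ<; inject≤; punchIn)
open import Data.Fin.Properties
  using (_≟_; any?; toℕ-fromℕ<; toℕ<n; toℕ-injective; inject≤-injective; punchInᵢ≢i; punchIn-injective)
open import Data.Fin.Permutation using (Permutation′; _⟨$⟩ʳ_; _⟨$⟩ˡ_; inverseʳ; inverseˡ; flip; _∘ₚ_)
import Data.Fin.Permutation as Permutation
open import Data.Fin.Permutation.Components using (transpose)
open import Data.Fin.Permutation.Transposition.List using (TranspositionList; eval; decompose; eval-decompose)
open import Data.Fin.Subset using (Subset; _∈_; _∉_; _⊆_; _─_; _-_; ⊤; ⊥; inside; outside; ∣_∣)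
open import Data.Fin.Subset.Properties
  using (_∈?_; ∈⊤; ∉⊥; ∣⊤∣≡n; ∣⊥∣≡0; ⊆-antisym; p⊂q⇒∣p∣<∣q∣; p─q⊆p; p─⊥≡p;
         x∈p∧x≢y⇒x∈p-y; x∉⁅y⁆⇒x≢y)
open import Data.List using ([]; _∷_)
open import Data.Nat using (NonZero; suc; _+_; _∸_; s≤s; z≤n)
open import Data.Nat.DivMod using (_%_; m%n<n; m%n%n≡m%n; [m+n]%n≡m%n; m<n⇒m%n≡m; %-distribˡ-+)
open import Data.Nat.Properties
  using (≤-trans; ≤-reflexive; <-irrefl; <⇒≤; +-identityʳ; +-commutativeSemigroup;
         m+[n∸m]≡n; m∸n≢0⇒n<m; m∸[m∸n]≡n)
open import Data.Product using (_,_; proj₂)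
open import Data.Vec using (_∷_; here; there; lookup; tabulate; _[_]≔_)
open import Data.Vec.Properties
  using (lookup∘tabulate; tabulate∘lookup; tabulate-cong; lookup∘update; lookup∘update′;
         []≔-lookup; []≔-idempotent; []≔-commutes)
open import Data.Vec.Functional using (updateAt)
open import Data.Vec.Functional.Properties using (updateAt-updates; updateAt-minimal)
open import Function using (_∘_; const)
open import Function.Bundles using (mk⇔; Equivalence)
open import Function.Construct.Composition using (_⇔-∘_)
open import Relation.Binary.PropositionalEquality using (refl; sym; trans; cong; subst; _≗_; module ≡-Reasoning)
open import Relation.Nullary using (¬_; Dec; yes; no; does; contradiction)
open import Relation.Nullary.Decidable using (decidable-stable; dec-true; dec-false; ¬?; _×-dec_)

open Equivalence using (to; from)

private
  variable
    A : Set
    k n : ℕ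

-- Vectors and permutations

lookup-extensionality : {a b : Vec A n} → (∀ l → lookup a l ≡ lookup b l) → a ≡ b
lookup-extensionality {a = a} {b} eq = begin
  a                    ≡⟨ tabulate∘lookup a ⟨
  tabulate (lookup a)  ≡⟨ tabulate-cong eq ⟩
  tabulate (lookup b)  ≡⟨ tabulate∘lookup b ⟩
  b                    ∎
  where open ≡-Reasoning

[]≔-[]≔-determined : {u v : Fin n} {x y : A} (a b : Vec A n) → u ≢ v → lookup b u ≡ x → lookup b v ≡ y →
                     (∀ l → l ≢ u → l ≢ v → lookup a l ≡ lookup b l) → (a [ v ]≔ y) [ u ]≔ x ≡ b
[]≔-[]≔-determined {u = u} {v} {x} {y} a b u≢v bᵤ≡x bᵥ≡y agree = lookup-extensionality at
  where
  at : ∀ l → lookup ((a [ v ]≔ y) [ u ]≔ x) l ≡ lookup b l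
  at l with l ≟ u | l ≟ v
  ... | yes refl | _ = trans (lookup∘update u (a [ v ]≔ y) x) (sym bᵤ≡x)
  ... | no l≢u | yes refl =
    trans (lookup∘update′ l≢u (a [ v ]≔ y) x) (trans (lookup∘update v a y) (sym bᵥ≡y))
  ... | no l≢u | no l≢v =
    trans (lookup∘update′ l≢u (a [ v ]≔ y) x) (trans (lookup∘update′ l≢v a y) (agree l l≢u l≢v))

transpose-matchˡ : (i j : Fin n) → transpose i j i ≡ j
transpose-matchˡ i j with i ≟ i
... | yes _ = refl
... | no i≢i = contradiction refl i≢i

transpose-matchʳ : (i j : Fin n) → transpose i j j ≡ i
transpose-matchʳ i j with j ≟ i
... | yes j≡i = j≡i
... | no _ with j ≟ j
...   | yes _ = refl
...   | no j≢j = contradiction refl j≢j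

transpose-noMatch : (i j : Fin n) {l : Fin n} → l ≢ i → l ≢ j → transpose i j l ≡ l
transpose-noMatch i j {l} l≢i l≢j with l ≟ i
... | yes l≡i = contradiction l≡i l≢i
... | no _ with l ≟ j
...   | yes l≡j = contradiction l≡j l≢j
...   | no _ = refl

transpose-comm : (i j : Fin n) → transpose i j ≗ transpose j i
transpose-comm i j l = cases (l ≟ i) (l ≟ j)
  where
  cases : Dec (l ≡ i) → Dec (l ≡ j) → transpose i j l ≡ transpose j i l
  cases (yes refl) _ = trans (transpose-matchˡ i j) (sym (transpose-matchʳ j i))
  cases (no _) (yes refl) = trans (transpose-matchʳ i j) (sym (transpose-matchˡ j i))
  cases (no l≢i) (no l≢j) = trans (transpose-noMatch i j l≢i l≢j) (sym (transpose-noMatch j i l≢j l≢i))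

transpose-conjugate : {u p q : Fin n} → u ≢ p → u ≢ q → p ≢ q →
                      ∀ l → transpose u p (transpose p q (transpose q u l)) ≡ transpose p q l
transpose-conjugate {u = u} {p} {q} u≢p u≢q p≢q l = cases (l ≟ u) (l ≟ p) (l ≟ q)
  where
  open ≡-Reasoning
  cases : Dec (l ≡ u) → Dec (l ≡ p) → Dec (l ≡ q) →
          transpose u p (transpose p q (transpose q u l)) ≡ transpose p q l
  cases (yes refl) _ _ = begin
    transpose l p (transpose p q (transpose q l l)) ≡⟨ cong (transpose l p ∘ transpose p q) (transpose-matchʳ q l) ⟩
    transpose l p (transpose p q q)                 ≡⟨ cong (transpose l p) (transpose-matchʳ p q) ⟩
    transpose l p p                                 ≡⟨ transpose-matchʳ l p ⟩
    l                                               ≡⟨ transpose-noMatch p q u≢p u≢q ⟨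
    transpose p q l                                 ∎
  cases (no l≢u) (yes refl) _ = begin
    transpose u l (transpose l q (transpose q u l)) ≡⟨ cong (transpose u l ∘ transpose l q) (transpose-noMatch q u p≢q l≢u) ⟩
    transpose u l (transpose l q l)                 ≡⟨ cong (transpose u l) (transpose-matchˡ l q) ⟩
    transpose u l q                                 ≡⟨ transpose-noMatch u l (u≢q ∘ sym) (p≢q ∘ sym) ⟩
    q                                               ≡⟨ transpose-matchˡ l q ⟨
    transpose l q l                                 ∎
  cases (no l≢u) (no l≢p) (yes refl) = begin
    transpose u p (transpose p l (transpose l u l)) ≡⟨ cong (transpose u p ∘ transpose p l) (transpose-matchˡ l u) ⟩
    transpose u p (transpose p l u)                 ≡⟨ cong (transpose u p) (transpose-noMatch p l u≢p u≢q) ⟩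
    transpose u p u                                 ≡⟨ transpose-matchˡ u p ⟩
    p                                               ≡⟨ transpose-matchʳ p l ⟨
    transpose p l l                                 ∎
  cases (no l≢u) (no l≢p) (no l≢q) = begin
    transpose u p (transpose p q (transpose q u l)) ≡⟨ cong (transpose u p ∘ transpose p q) (transpose-noMatch q u l≢q l≢u) ⟩
    transpose u p (transpose p q l)                 ≡⟨ cong (transpose u p) (transpose-noMatch p q l≢p l≢q) ⟩
    transpose u p l                                 ≡⟨ transpose-noMatch u p l≢u l≢p ⟩
    l                                               ≡⟨ transpose-noMatch p q l≢p l≢q ⟨
    transpose p q l                                 ∎

∘-transpose-invariant : (h : Fin n → A) {x r : Fin n} → h x ≡ h r → h ≗ h ∘ transpose x r
∘-transpose-invariant h {x} {r} hx≡hr l = cases (l ≟ x) (l ≟ r)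
  where
  cases : Dec (l ≡ x) → Dec (l ≡ r) → h l ≡ h (transpose x r l)
  cases (yes refl) _ = trans hx≡hr (cong h (sym (transpose-matchˡ l r)))
  cases (no _) (yes refl) = trans (sym hx≡hr) (cong h (sym (transpose-matchʳ x l)))
  cases (no l≢x) (no l≢r) = cong h (sym (transpose-noMatch x r l≢x l≢r))

pair-permutation : {i j i′ j′ : Fin n} → i ≢ j → i′ ≢ j′ →
                   ∃[ π ] (π ⟨$⟩ʳ i ≡ i′ × π ⟨$⟩ʳ j ≡ j′)
pair-permutation {i = i} {j} {i′} {j′} i≢j i′≢j′ =
  Permutation.transpose i i′ ∘ₚ Permutation.transpose j₁ j′ ,
  trans (cong (transpose j₁ j′) (transpose-matchˡ i i′)) (transpose-noMatch j₁ j′ (j₁≢i′ ∘ sym) i′≢j′) ,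
  transpose-matchˡ j₁ j′
  where
  j₁ = transpose i i′ j
  j₁≢i′ : j₁ ≢ i′
  j₁≢i′ j₁≡i′ = i≢j (begin
    i                 ≡⟨ transpose-matchˡ i′ i ⟨
    transpose i′ i i′ ≡⟨ cong (transpose i′ i) j₁≡i′ ⟨
    transpose i′ i j₁ ≡⟨ inverseˡ (Permutation.transpose i i′) ⟩
    j                 ∎)
    where open ≡-Reasoning

permute : Permutation′ n → Vec A n → Vec A n
permute π a = tabulate (λ l → lookup a (π ⟨$⟩ʳ l))

permute-update : (π : Permutation′ n) (a : Vec A n) (i : Fin n) (x : A) →
                 permute π a [ π ⟨$⟩ˡ i ]≔ x ≡ permute π (a [ i ]≔ x)
permute-update π a i x = lookup-extensionality at
  where
  open ≡-Reasoning
  at : ∀ l → lookup (permute π a [ π ⟨$⟩ˡ i ]≔ x) l ≡ lookup (permute π (a [ i ]≔ x)) l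
  at l with l ≟ π ⟨$⟩ˡ i
  ... | yes refl = begin
    lookup (permute π a [ π ⟨$⟩ˡ i ]≔ x) (π ⟨$⟩ˡ i) ≡⟨ lookup∘update (π ⟨$⟩ˡ i) (permute π a) x ⟩
    x                                               ≡⟨ lookup∘update i a x ⟨
    lookup (a [ i ]≔ x) i                           ≡⟨ cong (lookup (a [ i ]≔ x)) (inverseʳ π) ⟨
    lookup (a [ i ]≔ x) (π ⟨$⟩ʳ (π ⟨$⟩ˡ i))         ≡⟨ lookup∘tabulate _ (π ⟨$⟩ˡ i) ⟨
    lookup (permute π (a [ i ]≔ x)) (π ⟨$⟩ˡ i)      ∎
  ... | no l≢π⁻¹i = begin
    lookup (permute π a [ π ⟨$⟩ˡ i ]≔ x) l ≡⟨ lookup∘update′ l≢π⁻¹i (permute π a) x ⟩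
    lookup (permute π a) l                 ≡⟨ lookup∘tabulate _ l ⟩
    lookup a (π ⟨$⟩ʳ l)                    ≡⟨ lookup∘update′ πl≢i a x ⟨
    lookup (a [ i ]≔ x) (π ⟨$⟩ʳ l)         ≡⟨ lookup∘tabulate _ l ⟨
    lookup (permute π (a [ i ]≔ x)) l      ∎
    where
    πl≢i : π ⟨$⟩ʳ l ≢ i
    πl≢i πl≡i = l≢π⁻¹i (trans (sym (inverseˡ π)) (cong (π ⟨$⟩ˡ_) πl≡i))

-- Repeated entries

HasRepeat : (Fin n → A) → Set
HasRepeat {n = n} h = ∃[ u ] ∃[ v ] (u ≢ v × h u ≡ h v)

hasRepeat? : (h : Fin n → Fin k) → Dec (HasRepeat h)
hasRepeat? h = any? λ u → any? λ v → ¬? (u ≟ v) ×-dec (h u ≟ h v)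

HasRepeat-cong : {h h′ : Fin n → A} → h ≗ h′ → HasRepeat h → HasRepeat h′
HasRepeat-cong h≗h′ (u , v , u≢v , hᵤ≡hᵥ) = u , v , u≢v , trans (sym (h≗h′ u)) (trans hᵤ≡hᵥ (h≗h′ v))

HasRepeat-∘ : {h : Fin n → A} (π : Permutation′ n) → HasRepeat h → HasRepeat (h ∘ (π ⟨$⟩ʳ_))
HasRepeat-∘ {h = h} π (u , v , u≢v , hᵤ≡hᵥ) =
  π ⟨$⟩ˡ u , π ⟨$⟩ˡ v ,
  (λ eq → u≢v (trans (sym (inverseʳ π)) (trans (cong (π ⟨$⟩ʳ_) eq) (inverseʳ π)))) ,
  trans (cong h (inverseʳ π)) (trans hᵤ≡hᵥ (cong h (sym (inverseʳ π))))

HasRepeat-∘⁻ : {h : Fin n → A} (π : Permutation′ n) → HasRepeat (h ∘ (π ⟨$⟩ʳ_)) → HasRepeat h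
HasRepeat-∘⁻ {h = h} π rep = HasRepeat-cong (λ _ → cong h (inverseʳ π)) (HasRepeat-∘ (flip π) rep)

HasRepeat-permute : {a : Vec A n} (π : Permutation′ n) → HasRepeat (lookup a) → HasRepeat (lookup (permute π a))
HasRepeat-permute π rep = HasRepeat-cong (λ l → sym (lookup∘tabulate _ l)) (HasRepeat-∘ π rep)

HasRepeat-permute⁻ : {a : Vec A n} (π : Permutation′ n) → HasRepeat (lookup (permute π a)) → HasRepeat (lookup a)
HasRepeat-permute⁻ π rep = HasRepeat-∘⁻ π (HasRepeat-cong (lookup∘tabulate _) rep)

HasRepeat-identified : {i j : Fin n} → i ≢ j → (a : Vec A n) → HasRepeat (lookup (a [ i ]≔ lookup a j))
HasRepeat-identified {i = i} {j} i≢j a =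
  i , j , i≢j , trans (lookup∘update i a _) (sym (lookup∘update′ (i≢j ∘ sym) a _))

repeat-free-vector : n ≤ k → ∃[ d ] ¬ HasRepeat (lookup {A = Fin k} {n = n} d)
repeat-free-vector n≤k = tabulate (λ i → inject≤ i n≤k) , λ (u , v , u≢v , dᵤ≡dᵥ) →
  u≢v (inject≤-injective n≤k n≤k u v (trans (sym (lookup∘tabulate _ u)) (trans dᵤ≡dᵥ (lookup∘tabulate _ v))))

-- Essential variables and their number

x∈p─q⇒x∉q : {p q : Subset n} {x : Fin n} → x ∈ p ─ q → x ∉ q
x∈p─q⇒x∉q {p = _ ∷ _} {outside ∷ _} here ()
x∈p─q⇒x∉q {p = _ ∷ _} {_ ∷ _} (there x∈p─q) (there x∈q) = x∈p─q⇒x∉q x∈p─q x∈q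

x∈p-y⇒x≢y : {p : Subset n} {x y : Fin n} → x ∈ p - y → x ≢ y
x∈p-y⇒x≢y x∈p-y = x∉⁅y⁆⇒x≢y (x∈p─q⇒x∉q x∈p-y)

x∈p⇒suc∣p-x∣≡∣p∣ : {p : Subset n} {x : Fin n} → x ∈ p → suc ∣ p - x ∣ ≡ ∣ p ∣
x∈p⇒suc∣p-x∣≡∣p∣ {p = inside ∷ p} here = cong (suc ∘ ∣_∣) (p─⊥≡p p)
x∈p⇒suc∣p-x∣≡∣p∣ {p = inside ∷ _} (there x∈p) = cong suc (x∈p⇒suc∣p-x∣≡∣p∣ x∈p)
x∈p⇒suc∣p-x∣≡∣p∣ {p = outside ∷ _} (there x∈p) = x∈p⇒suc∣p-x∣≡∣p∣ x∈p

x∈⊤-i-j⇔ : {i j x : Fin n} → x ∈ ⊤ - i - j ⇔ (x ≢ i × x ≢ j)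
x∈⊤-i-j⇔ = mk⇔
  (λ x∈ → x∈p-y⇒x≢y (p─q⊆p _ _ x∈) , x∈p-y⇒x≢y x∈)
  (λ (x≢i , x≢j) → x∈p∧x≢y⇒x∈p-y (x∈p∧x≢y⇒x∈p-y ∈⊤ x≢i) x≢j)

∣⊤-i-j∣≡n∸2 : {i j : Fin n} → i ≢ j → ∣ ⊤ {n} - i - j ∣ ≡ n ∸ 2
∣⊤-i-j∣≡n∸2 {n = n} {i} {j} i≢j = cong (_∸ 2) (begin
  suc (suc ∣ ⊤ - i - j ∣) ≡⟨ cong suc (x∈p⇒suc∣p-x∣≡∣p∣ j∈⊤-i) ⟩
  suc ∣ ⊤ - i ∣           ≡⟨ x∈p⇒suc∣p-x∣≡∣p∣ (∈⊤ {x = i}) ⟩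
  ∣ ⊤ {n} ∣               ≡⟨ ∣⊤∣≡n n ⟩
  n                       ∎)
  where
  open ≡-Reasoning
  j∈⊤-i : j ∈ ⊤ - i
  j∈⊤-i = x∈p∧x≢y⇒x∈p-y ∈⊤ (i≢j ∘ sym)

p⊆q∧∣q∣≤∣p∣⇒q⊆p : {p q : Subset n} → p ⊆ q → ∣ q ∣ ≤ ∣ p ∣ → q ⊆ p
p⊆q∧∣q∣≤∣p∣⇒q⊆p {p = p} p⊆q ∣q∣≤∣p∣ {x} x∈q with x ∈? p
... | yes x∈p = x∈p
... | no x∉p = contradiction (≤-trans (p⊂q⇒∣p∣<∣q∣ (p⊆q , x , x∈q , x∉p)) ∣q∣≤∣p∣) (<-irrefl refl)

inessential⇒invariant : {g : Op k n} {i : Fin n} → ¬ Essential g i → ∀ a c → g a ≡ g (a [ i ]≔ c)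
inessential⇒invariant {g = g} {i} ¬ess a c = decidable-stable (g a ≟ g (a [ i ]≔ c)) (λ ne → ¬ess (a , c , ne))

Essential-cong : {g g′ : Op k n} → g ≗ g′ → (l : Fin n) → Essential g l ⇔ Essential g′ l
Essential-cong g≗g′ l = mk⇔ (along g≗g′) (along (sym ∘ g≗g′))
  where
  along : {g g′ : Op _ _} → g ≗ g′ → Essential g l → Essential g′ l
  along g≗g′ (a , c , ne) = a , c , λ eq → ne (trans (g≗g′ a) (trans eq (sym (g≗g′ _))))

ident-target-inessential : (g : Op k n) {i j : Fin n} → i ≢ j → ¬ Essential (ident g i j) i
ident-target-inessential g {i} {j} i≢j (a , c , ne) = ne (cong g (begin
  a [ i ]≔ lookup a j                       ≡⟨ []≔-idempotent a i ⟨
  (a [ i ]≔ c) [ i ]≔ lookup a j            ≡⟨ cong ((a [ i ]≔ c) [ i ]≔_) (lookup∘update′ (i≢j ∘ sym) a c) ⟨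
  (a [ i ]≔ c) [ i ]≔ lookup (a [ i ]≔ c) j ∎))
  where open ≡-Reasoning

Essential-ident⇒Essential : (g : Op k n) {i j l : Fin n} → l ≢ i → l ≢ j →
                            Essential (ident g i j) l → Essential g l
Essential-ident⇒Essential g {i} {j} {l} l≢i l≢j (a , c , ne) =
  a [ i ]≔ lookup a j , c , λ eq → ne (trans eq (cong g (begin
    (a [ i ]≔ lookup a j) [ l ]≔ c            ≡⟨ []≔-commutes a i l (l≢i ∘ sym) ⟩
    (a [ l ]≔ c) [ i ]≔ lookup a j            ≡⟨ cong ((a [ l ]≔ c) [ i ]≔_) (lookup∘update′ (l≢j ∘ sym) a c) ⟨
    (a [ l ]≔ c) [ i ]≔ lookup (a [ l ]≔ c) j ∎)))
  where open ≡-Reasoning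

EssCount-unique : {g : Op k n} {m m′ : ℕ} → EssCount g m → EssCount g m′ → m ≡ m′
EssCount-unique (S , S⇔ , ∣S∣≡m) (T , T⇔ , ∣T∣≡m′) = begin
  _     ≡⟨ ∣S∣≡m ⟨
  ∣ S ∣ ≡⟨ cong ∣_∣ (⊆-antisym (from (T⇔ _) ∘ to (S⇔ _)) (from (S⇔ _) ∘ to (T⇔ _))) ⟩
  ∣ T ∣ ≡⟨ ∣T∣≡m′ ⟩
  _     ∎
  where open ≡-Reasoning

EssCount-all : {g : Op k n} → (∀ i → Essential g i) → EssCount g n
EssCount-all {n = n} ess = ⊤ , (λ i → mk⇔ (λ _ → ess i) (λ _ → ∈⊤)) , ∣⊤∣≡n n

EssCount-none : {g : Op k n} → (∀ i → ¬ Essential g i) → EssCount g 0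
EssCount-none {n = n} ¬ess =
  ⊥ , (λ i → mk⇔ (λ i∈⊥ → contradiction i∈⊥ ∉⊥) (λ ess → contradiction ess (¬ess i))) , ∣⊥∣≡0 n

EssCount-all-but : {g : Op k n} {i j : Fin n} → i ≢ j → (∀ l → Essential g l ⇔ (l ≢ i × l ≢ j)) →
                   EssCount g (n ∸ 2)
EssCount-all-but i≢j ess⇔ =
  ⊤ - _ - _ ,
  (λ l → mk⇔ (from (ess⇔ l) ∘ to x∈⊤-i-j⇔) (from x∈⊤-i-j⇔ ∘ to (ess⇔ l))) ,
  ∣⊤-i-j∣≡n∸2 i≢j

Essential-from-EssCount : {g : Op k n} {S : Subset n} → EssCount g ∣ S ∣ →
                          (∀ l → Essential g l → l ∈ S) → {l : Fin n} → l ∈ S → Essential g l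
Essential-from-EssCount (T , T⇔ , ∣T∣≡∣S∣) ess⇒∈S l∈S =
  to (T⇔ _) (p⊆q∧∣q∣≤∣p∣⇒q⊆p T⊆S (≤-reflexive (sym ∣T∣≡∣S∣)) l∈S)
  where
  T⊆S : T ⊆ _
  T⊆S {l} = ess⇒∈S l ∘ to (T⇔ l)

InG-uniform : {g : Op k (2 + n)} {m : ℕ} → (∀ i → Essential g i) →
              (∀ i j → i ≢ j → EssCount (ident g i j) m) → InG (2 + n ∸ m) (2 + n) g
InG-uniform {m = m} ess count =
  EssCount-all ess ,
  _ , m , EssCount-all ess ,
  ((zero , suc zero , (λ ()) , ess zero , ess (suc zero) , count zero (suc zero) (λ ())) ,
   (λ i j i≢j _ _ m′ count′ → ≤-reflexive (EssCount-unique count′ (count i j i≢j)))) ,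
  refl

two-others : (i : Fin (3 + n)) → ∃[ j ] ∃[ l ] (j ≢ l × i ≢ j × i ≢ l)
two-others i =
  punchIn i zero , punchIn i (suc zero) ,
  (λ eq → contradiction (punchIn-injective i zero (suc zero) eq) λ ()) ,
  punchInᵢ≢i i zero ∘ sym , punchInᵢ≢i i (suc zero) ∘ sym

Essential-from-identifications : {g : Op k (3 + n)} →
                                 (∀ i j → i ≢ j → ∀ l → l ≢ i → l ≢ j → Essential (ident g i j) l) →
                                 ∀ x → Essential g x
Essential-from-identifications {g = g} ess x with two-others x
... | j , l , j≢l , x≢j , x≢l = Essential-ident⇒Essential g x≢j x≢l (ess j l j≢l x x≢j x≢l)

2≡m∸n⇒n≡m∸2 : {m n : ℕ} → 2 ≡ m ∸ n → n ≡ m ∸ 2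
2≡m∸n⇒n≡m∸2 {m} {n} 2≡m∸n = begin
  n           ≡⟨ m∸[m∸n]≡n (<⇒≤ n<m) ⟨
  m ∸ (m ∸ n) ≡⟨ cong (m ∸_) 2≡m∸n ⟨
  m ∸ 2       ∎
  where
  open ≡-Reasoning
  n<m : n < m
  n<m = m∸n≢0⇒n<m (λ m∸n≡0 → contradiction (trans 2≡m∸n m∸n≡0) λ ())

gap-two-pair : {f : Op k n} → EssCount f n → Gap f 2 → ∃[ i ] ∃[ j ] (i ≢ j × EssCount (ident f i j) (n ∸ 2))
gap-two-pair {f = f} count-f (m , m′ , count-m , ((i , j , i≢j , _ , _ , count′) , _) , 2≡m∸m′) =
  i , j , i≢j , subst (EssCount (ident f i j)) m′≡n∸2 count′
  where
  m′≡n∸2 = trans (2≡m∸n⇒n≡m∸2 2≡m∸m′) (cong (_∸ 2) (EssCount-unique count-m count-f))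

-- Symmetry on vectors with a repeated entry

module Symmetric-on-repeats {k n : ℕ} (f : Op k n)
  (forgets : ∀ u v → u ≢ v → ¬ Essential (ident f u v) v) where

  F : (Fin n → Fin k) → Fin k
  F h = f (tabulate h)

  F-cong : {h h′ : Fin n → Fin k} → h ≗ h′ → F h ≡ F h′
  F-cong = cong f ∘ tabulate-cong

  -- On the diagonal x_u = x_v the value of f does not depend on the common value of x_u and x_v:
  -- x_u is overwritten by the identification and x_v is inessential after it.
  diagonal-move : {u v : Fin n} {h h′ : Fin n → Fin k} → u ≢ v → h u ≡ h v → h′ u ≡ h′ v →
                  (∀ l → l ≢ u → l ≢ v → h l ≡ h′ l) → F h ≡ F h′
  diagonal-move {u} {v} {h} {h′} u≢v hᵤ≡hᵥ h′ᵤ≡h′ᵥ agree = begin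
    f a                         ≡⟨ cong f a-fixed ⟨
    ident f u v a               ≡⟨ inessential⇒invariant (forgets u v u≢v) a (h′ v) ⟩
    ident f u v (a [ v ]≔ h′ v) ≡⟨ cong f b-fixed ⟩
    f b                         ∎
    where
    open ≡-Reasoning
    a = tabulate h
    b = tabulate h′
    a-fixed : a [ u ]≔ lookup a v ≡ a
    a-fixed = begin
      a [ u ]≔ lookup a v ≡⟨ cong (a [ u ]≔_) (lookup∘tabulate h v) ⟩
      a [ u ]≔ h v        ≡⟨ cong (a [ u ]≔_) (trans (sym hᵤ≡hᵥ) (sym (lookup∘tabulate h u))) ⟩
      a [ u ]≔ lookup a u ≡⟨ []≔-lookup a u ⟩
      a                   ∎
    b-fixed : (a [ v ]≔ h′ v) [ u ]≔ lookup (a [ v ]≔ h′ v) v ≡ b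
    b-fixed = trans (cong ((a [ v ]≔ h′ v) [ u ]≔_) (lookup∘update v a (h′ v)))
                    ([]≔-[]≔-determined a b u≢v (trans (lookup∘tabulate h′ u) h′ᵤ≡h′ᵥ) (lookup∘tabulate h′ v) agree′)
      where
      agree′ : ∀ l → l ≢ u → l ≢ v → lookup a l ≡ lookup b l
      agree′ l l≢u l≢v = trans (lookup∘tabulate h l) (trans (agree l l≢u l≢v) (sym (lookup∘tabulate h′ l)))

  -- Two diagonal moves: first set the twins w, x to h r, then the new twins w, r to h x.
  swap-at-twin : {h : Fin n → Fin k} {w x : Fin n} → w ≢ x → h w ≡ h x →
                 ∀ r → F h ≡ F (h ∘ transpose x r)
  swap-at-twin {h} {w} {x} w≢x hw≡hx r with h x ≟ h r
  ... | yes hx≡hr = F-cong (∘-transpose-invariant h hx≡hr)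
  ... | no hx≢hr =
    trans (diagonal-move w≢x hw≡hx (trans h₁w (sym h₁x)) (λ l l≢w l≢x → sym (h₁-other l≢w l≢x)))
          (diagonal-move (r≢w ∘ sym) (trans h₁w (sym (h₁-other r≢w r≢x))) (trans h′w (sym h′r)) agree)
    where
    r≢x : r ≢ x
    r≢x r≡x = hx≢hr (cong h (sym r≡x))
    r≢w : r ≢ w
    r≢w r≡w = hx≢hr (trans (sym hw≡hx) (cong h (sym r≡w)))
    h₁ : Fin n → Fin k
    h₁ = updateAt (updateAt h x (const (h r))) w (const (h r))
    h₁w : h₁ w ≡ h r
    h₁w = updateAt-updates w (updateAt h x (const (h r)))
    h₁x : h₁ x ≡ h r
    h₁x = trans (updateAt-minimal x w _ (w≢x ∘ sym)) (updateAt-updates x h)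
    h₁-other : ∀ {l} → l ≢ w → l ≢ x → h₁ l ≡ h l
    h₁-other {l} l≢w l≢x = trans (updateAt-minimal l w _ l≢w) (updateAt-minimal l x h l≢x)
    h′w : h (transpose x r w) ≡ h x
    h′w = trans (cong h (transpose-noMatch x r w≢x (r≢w ∘ sym))) hw≡hx
    h′r : h (transpose x r r) ≡ h x
    h′r = cong h (transpose-matchʳ x r)
    agree : ∀ l → l ≢ w → l ≢ r → h₁ l ≡ h (transpose x r l)
    agree l l≢w l≢r = cases (l ≟ x)
      where
      cases : Dec (l ≡ x) → h₁ l ≡ h (transpose x r l)
      cases (yes refl) = trans h₁x (cong h (sym (transpose-matchˡ l r)))
      cases (no l≢x) = trans (h₁-other l≢w l≢x) (cong h (sym (transpose-noMatch x r l≢x l≢r)))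

  swap-invariant : {h : Fin n → Fin k} → HasRepeat h → ∀ p q → F h ≡ F (h ∘ transpose p q)
  swap-invariant {h} (u , v , u≢v , hᵤ≡hᵥ) p q = cases (p ≟ u) (p ≟ v) (q ≟ u) (q ≟ v) (p ≟ q)
    where
    open ≡-Reasoning
    swapped : F (h ∘ transpose q p) ≡ F (h ∘ transpose p q)
    swapped = F-cong (cong h ∘ transpose-comm q p)
    cases : Dec (p ≡ u) → Dec (p ≡ v) → Dec (q ≡ u) → Dec (q ≡ v) → Dec (p ≡ q) →
            F h ≡ F (h ∘ transpose p q)
    cases (yes refl) _ _ _ _ = swap-at-twin (u≢v ∘ sym) (sym hᵤ≡hᵥ) q
    cases _ (yes refl) _ _ _ = swap-at-twin u≢v hᵤ≡hᵥ q
    cases _ _ (yes refl) _ _ = trans (swap-at-twin (u≢v ∘ sym) (sym hᵤ≡hᵥ) p) swapped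
    cases _ _ _ (yes refl) _ = trans (swap-at-twin u≢v hᵤ≡hᵥ p) swapped
    cases _ _ _ _ (yes refl) = F-cong (∘-transpose-invariant h refl)
    cases (no p≢u) (no p≢v) (no q≢u) (no q≢v) (no p≢q) = begin
      F h                                    ≡⟨ swap-at-twin (u≢v ∘ sym) (sym hᵤ≡hᵥ) p ⟩
      F h₁                                   ≡⟨ swap-at-twin (p≢v ∘ sym) h₁v≡h₁p q ⟩
      F (h₁ ∘ transpose p q)                 ≡⟨ swap-at-twin (q≢v ∘ sym) h₂v≡h₂q u ⟩
      F (h₁ ∘ transpose p q ∘ transpose q u) ≡⟨ F-cong (cong h ∘ transpose-conjugate (p≢u ∘ sym) (q≢u ∘ sym) p≢q) ⟩
      F (h ∘ transpose p q)                  ∎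
      where
      h₁ : Fin n → Fin k
      h₁ = h ∘ transpose u p
      h₁v≡h₁p : h₁ v ≡ h₁ p
      h₁v≡h₁p = trans (cong h (transpose-noMatch u p (u≢v ∘ sym) (p≢v ∘ sym)))
                      (trans (sym hᵤ≡hᵥ) (cong h (sym (transpose-matchʳ u p))))
      h₂v≡h₂q : h₁ (transpose p q v) ≡ h₁ (transpose p q q)
      h₂v≡h₂q = trans (cong h₁ (transpose-noMatch p q (p≢v ∘ sym) (q≢v ∘ sym)))
                      (trans h₁v≡h₁p (cong h₁ (sym (transpose-matchʳ p q))))

  transpositions-invariant : {h : Fin n → Fin k} → HasRepeat h →
                             (xs : TranspositionList n) → F h ≡ F (h ∘ (eval xs ⟨$⟩ʳ_))
  transpositions-invariant rep [] = refl
  transpositions-invariant rep ((i , j) ∷ xs) =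
    trans (transpositions-invariant rep xs) (swap-invariant (HasRepeat-∘ (eval xs) rep) i j)

  permute-invariant : {a : Vec (Fin k) n} → HasRepeat (lookup a) → (π : Permutation′ n) →
                      f a ≡ f (permute π a)
  permute-invariant {a} rep π = begin
    f a                                       ≡⟨ cong f (tabulate∘lookup a) ⟨
    F (lookup a)                              ≡⟨ transpositions-invariant rep (decompose π) ⟩
    F (lookup a ∘ (eval (decompose π) ⟨$⟩ʳ_)) ≡⟨ F-cong (cong (lookup a) ∘ eval-decompose π) ⟩
    f (permute π a)                           ∎
    where open ≡-Reasoning

  ident-permute : {i j : Fin n} → i ≢ j → (π : Permutation′ n) (a : Vec (Fin k) n) →
                  ident f (π ⟨$⟩ˡ i) (π ⟨$⟩ˡ j) (permute π a) ≡ ident f i j a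
  ident-permute {i} {j} i≢j π a = begin
    f (permute π a [ π ⟨$⟩ˡ i ]≔ lookup (permute π a) (π ⟨$⟩ˡ j)) ≡⟨ cong (λ x → f (permute π a [ π ⟨$⟩ˡ i ]≔ x)) lookup-j ⟩
    f (permute π a [ π ⟨$⟩ˡ i ]≔ lookup a j)                      ≡⟨ cong f (permute-update π a i (lookup a j)) ⟩
    f (permute π (a [ i ]≔ lookup a j))                           ≡⟨ permute-invariant (HasRepeat-identified i≢j a) π ⟨
    f (a [ i ]≔ lookup a j)                                       ∎
    where
    open ≡-Reasoning
    lookup-j : lookup (permute π a) (π ⟨$⟩ˡ j) ≡ lookup a j
    lookup-j = trans (lookup∘tabulate _ (π ⟨$⟩ˡ j)) (cong (lookup a) (inverseʳ π))

  Essential-ident-permute : {i j l : Fin n} → i ≢ j → (π : Permutation′ n) →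
                            Essential (ident f i j) l → Essential (ident f (π ⟨$⟩ˡ i) (π ⟨$⟩ˡ j)) (π ⟨$⟩ˡ l)
  Essential-ident-permute {i} {j} {l} i≢j π (a , c , ne) = permute π a , c , λ eq → ne (begin
    ident f i j a                   ≡⟨ ident-permute i≢j π a ⟨
    g (permute π a)                 ≡⟨ eq ⟩
    g (permute π a [ π ⟨$⟩ˡ l ]≔ c) ≡⟨ cong g (permute-update π a l c) ⟩
    g (permute π (a [ l ]≔ c))      ≡⟨ ident-permute i≢j π (a [ l ]≔ c) ⟩
    ident f i j (a [ l ]≔ c)        ∎)
    where
    open ≡-Reasoning
    g = ident f (π ⟨$⟩ˡ i) (π ⟨$⟩ˡ j)

  Essential-ident⇒distinct : {i j l : Fin n} → i ≢ j → Essential (ident f i j) l → l ≢ i × l ≢ j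
  Essential-ident⇒distinct {i} {j} i≢j ess =
    (λ { refl → ident-target-inessential f i≢j ess }) , (λ { refl → forgets i j i≢j ess })

  Essential-ident-transfer : {i₀ j₀ : Fin n} → i₀ ≢ j₀ →
                             (∀ l → l ≢ i₀ → l ≢ j₀ → Essential (ident f i₀ j₀) l) →
                             ∀ i j → i ≢ j → ∀ l → Essential (ident f i j) l ⇔ (l ≢ i × l ≢ j)
  Essential-ident-transfer {i₀} {j₀} i₀≢j₀ base i j i≢j l with pair-permutation i₀≢j₀ i≢j
  ... | ρ , refl , refl = mk⇔ (Essential-ident⇒distinct i≢j) λ (l≢ρi₀ , l≢ρj₀) →
    subst (Essential (ident f (ρ ⟨$⟩ʳ i₀) (ρ ⟨$⟩ʳ j₀))) (inverseʳ ρ)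
      (Essential-ident-permute i₀≢j₀ (flip ρ) (base (ρ ⟨$⟩ˡ l) (moved l≢ρi₀) (moved l≢ρj₀)))
    where
    moved : ∀ {y} → l ≢ ρ ⟨$⟩ʳ y → ρ ⟨$⟩ˡ l ≢ y
    moved l≢ρy ρ⁻¹l≡y = l≢ρy (trans (sym (inverseʳ ρ)) (cong (ρ ⟨$⟩ʳ_) ρ⁻¹l≡y))

  Essential-ident-from-count : {i₀ j₀ : Fin n} → i₀ ≢ j₀ → EssCount (ident f i₀ j₀) (n ∸ 2) →
                               ∀ l → l ≢ i₀ → l ≢ j₀ → Essential (ident f i₀ j₀) l
  Essential-ident-from-count i₀≢j₀ count l l≢i₀ l≢j₀ =
    Essential-from-EssCount (subst (EssCount _) (sym (∣⊤-i-j∣≡n∸2 i₀≢j₀)) count)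
      (λ _ ess → from x∈⊤-i-j⇔ (Essential-ident⇒distinct i₀≢j₀ ess)) (from x∈⊤-i-j⇔ (l≢i₀ , l≢j₀))

  Essential-ident-from-gap : EssCount f n → Gap f 2 →
                             ∀ i j → i ≢ j → ∀ l → Essential (ident f i j) l ⇔ (l ≢ i × l ≢ j)
  Essential-ident-from-gap count-f gap-f with gap-two-pair count-f gap-f
  ... | i₀ , j₀ , i₀≢j₀ , count₀ =
    Essential-ident-transfer i₀≢j₀ (Essential-ident-from-count i₀≢j₀ count₀)

-- The decomposition f = t ⊕ g

⊕K-identityʳ : (x y : Fin (suc k)) → toℕ y ≡ 0 → x ⊕K y ≡ x
⊕K-identityʳ {k = k} x y y≡0 = toℕ-injective (begin
  toℕ (x ⊕K y)            ≡⟨ toℕ-fromℕ< _ ⟩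
  (toℕ x + toℕ y) % suc k ≡⟨ cong (λ m → (toℕ x + m) % suc k) y≡0 ⟩
  (toℕ x + 0) % suc k     ≡⟨ cong (_% suc k) (+-identityʳ (toℕ x)) ⟩
  toℕ x % suc k           ≡⟨ m<n⇒m%n≡m (toℕ<n x) ⟩
  toℕ x                   ∎)
  where open ≡-Reasoning

_⊖K_ : Fin (suc k) → Fin (suc k) → Fin (suc k)
_⊖K_ {k = k} x y = fromℕ< (m%n<n (toℕ x + (suc k ∸ toℕ y)) (suc k))

[m+n%d]%d≡[m+n]%d : ∀ m n d .{{_ : NonZero d}} → (m + n % d) % d ≡ (m + n) % d
[m+n%d]%d≡[m+n]%d m n d = begin
  (m + n % d) % d         ≡⟨ %-distribˡ-+ m (n % d) d ⟩
  (m % d + n % d % d) % d ≡⟨ cong (λ r → (m % d + r) % d) (m%n%n≡m%n n d) ⟩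
  (m % d + n % d) % d     ≡⟨ %-distribˡ-+ m n d ⟨
  (m + n) % d             ∎
  where open ≡-Reasoning

⊕K-⊖K-cancel : (x y : Fin (suc k)) → y ⊕K (x ⊖K y) ≡ x
⊕K-⊖K-cancel {k = k} x y = toℕ-injective (begin
  toℕ (y ⊕K (x ⊖K y))                     ≡⟨ toℕ-fromℕ< _ ⟩
  (toℕ y + toℕ (x ⊖K y)) % K              ≡⟨ cong (λ m → (toℕ y + m) % K) (toℕ-fromℕ< _) ⟩
  (toℕ y + (toℕ x + (K ∸ toℕ y)) % K) % K ≡⟨ [m+n%d]%d≡[m+n]%d (toℕ y) _ K ⟩
  (toℕ y + (toℕ x + (K ∸ toℕ y))) % K     ≡⟨ cong (_% K) (x∙yz≈y∙xz +-commutativeSemigroup (toℕ y) (toℕ x) _) ⟩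
  (toℕ x + (toℕ y + (K ∸ toℕ y))) % K     ≡⟨ cong (λ m → (toℕ x + m) % K) (m+[n∸m]≡n (<⇒≤ (toℕ<n y))) ⟩
  (toℕ x + K) % K                         ≡⟨ [m+n]%n≡m%n (toℕ x) K ⟩
  toℕ x % K                               ≡⟨ m<n⇒m%n≡m (toℕ<n x) ⟩
  toℕ x                                   ∎)
  where
  K = suc k
  open ≡-Reasoning

other-than : (x : Fin (2 + k)) → ∃[ c ] c ≢ x
other-than zero = suc zero , λ ()
other-than (suc _) = zero , λ ()

if-repeat : (a : Vec (Fin k) n) → HasRepeat (lookup a) → (x y : A) →
            (if does (hasRepeat? (lookup a)) then x else y) ≡ x
if-repeat a rep x y rewrite dec-true (hasRepeat? (lookup a)) rep = refl

if-no-repeat : (a : Vec (Fin k) n) → ¬ HasRepeat (lookup a) → (x y : A) →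
               (if does (hasRepeat? (lookup a)) then x else y) ≡ y
if-no-repeat a ¬rep x y rewrite dec-false (hasRepeat? (lookup a)) ¬rep = refl

module Split {k n : ℕ} (f : Op (suc k) n) (c : Fin (suc k)) where

  t g : Op (suc k) n
  t a = if does (hasRepeat? (lookup a)) then f a else c
  g a = if does (hasRepeat? (lookup a)) then zero else f a ⊖K c

  split : ∀ a → f a ≡ (t ⊕ g) a
  split a with hasRepeat? (lookup a)
  ... | yes _ = sym (⊕K-identityʳ (f a) zero refl)
  ... | no _ = sym (⊕K-⊖K-cancel (f a) c)

  ident-g : {i j : Fin n} → i ≢ j → ∀ a → ident g i j a ≡ zero
  ident-g {i} {j} i≢j a = if-repeat (a [ i ]≔ lookup a j) (HasRepeat-identified i≢j a) _ _

  ident-g-inessential : {i j : Fin n} → i ≢ j → ∀ l → ¬ Essential (ident g i j) l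
  ident-g-inessential i≢j l (a , _ , ne) = ne (trans (ident-g i≢j a) (sym (ident-g i≢j _)))

  ident-t : {i j : Fin n} → i ≢ j → ident t i j ≗ ident f i j
  ident-t {i} {j} i≢j a = if-repeat (a [ i ]≔ lookup a j) (HasRepeat-identified i≢j a) _ _

  t-symmetric : (∀ {a} → HasRepeat (lookup a) → (π : Permutation′ n) → f a ≡ f (permute π a)) → TotSym t
  t-symmetric f-symmetric π a with hasRepeat? (lookup a)
  ... | yes rep = trans (f-symmetric rep π) (sym (if-repeat (permute π a) (HasRepeat-permute {a = a} π rep) _ _))
  ... | no ¬rep = sym (if-no-repeat (permute π a) (¬rep ∘ HasRepeat-permute⁻ {a = a} π) _ _)

  Essential-g : {d : Vec (Fin (suc k)) n} → ¬ HasRepeat (lookup d) → c ≢ f d →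
                {i j : Fin n} → i ≢ j → Essential g i
  Essential-g {d} ¬rep c≢fd {i} {j} i≢j = d , lookup d j , λ eq → c≢fd (begin
    c               ≡⟨ ⊕K-identityʳ c zero refl ⟨
    c ⊕K zero       ≡⟨ cong (c ⊕K_) (trans (sym (ident-g i≢j d)) (sym eq)) ⟩
    c ⊕K g d        ≡⟨ cong (c ⊕K_) (if-no-repeat d ¬rep _ _) ⟩
    c ⊕K (f d ⊖K c) ≡⟨ ⊕K-⊖K-cancel (f d) c ⟩
    f d             ∎)
    where open ≡-Reasoning

InGminus-from-split : {f t g : Op (suc k) (3 + n)} → (∀ a → f a ≡ (t ⊕ g) a) →
                      (∀ (i j : Fin (3 + n)) → i ≢ j → ∀ a → toℕ (ident g i j a) ≡ 0) →
                      (∀ (i j : Fin (3 + n)) → i ≢ j → ∀ l → Essential (ident t i j) l ⇔ (l ≢ i × l ≢ j)) →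
                      InGminus 2 f
InGminus-from-split {n = n} {f} {t} {g} f≗t⊕g g-vanishes t-ess =
  subst (λ p → InG p (3 + n) f) (m∸[m∸n]≡n {3 + n} (s≤s (s≤s z≤n)))
    (InG-uniform essential (λ i j i≢j → EssCount-all-but i≢j (f-ess i j i≢j))) ,
  λ u v u≢v ess → proj₂ (to (f-ess u v u≢v v) ess) refl
  where
  ident-f : ∀ i j → i ≢ j → ident f i j ≗ ident t i j
  ident-f i j i≢j a = trans (f≗t⊕g _) (⊕K-identityʳ _ _ (g-vanishes i j i≢j a))
  f-ess : ∀ i j → i ≢ j → ∀ l → Essential (ident f i j) l ⇔ (l ≢ i × l ≢ j)
  f-ess i j i≢j l = t-ess i j i≢j l ⇔-∘ Essential-cong (ident-f i j i≢j) l
  essential : ∀ x → Essential f x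
  essential = Essential-from-identifications (λ i j i≢j l l≢i l≢j → from (f-ess i j i≢j l) (l≢i , l≢j))

split-from-InGminus : {f : Op (2 + k) (3 + n)} → 3 + n ≤ 2 + k → InGminus 2 f →
  ∃[ t ] ∃[ g ]
    ((∀ a → f a ≡ (t ⊕ g) a)
    × InG (3 + n) (3 + n) g
    × (∀ (i j : Fin (3 + n)) → i ≢ j → ∀ a → toℕ (ident g i j a) ≡ 0)
    × TotSym t
    × (∀ (i j : Fin (3 + n)) → i ≢ j → ∀ l → Essential (ident t i j) l ⇔ (l ≢ i × l ≢ j)))
split-from-InGminus {f = f} n≤k ((count-f , gap-f) , forgets) with repeat-free-vector n≤k
... | d , ¬rep with other-than (f d)
... | c , c≢fd =
  t , g , split ,
  InG-uniform (λ i → Essential-g ¬rep c≢fd (punchInᵢ≢i i zero ∘ sym))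
              (λ i j i≢j → EssCount-none (ident-g-inessential i≢j)) ,
  (λ i j i≢j a → cong toℕ (ident-g i≢j a)) ,
  t-symmetric permute-invariant ,
  λ i j i≢j l → Essential-ident-from-gap count-f gap-f i j i≢j l ⇔-∘ Essential-cong (ident-t i≢j) l
  where
  open Symmetric-on-repeats f forgets
  open Split f c

theorem4p9 : (k n : ℕ) → 3 ≤ k → 3 < n → n ≤ k → (f : Op k n) →
    InGminus 2 f ⇔
    (∃[ t ] ∃[ g ]
      ((∀ a → f a ≡ (t ⊕ g) a)
      × InG n n g
      × (∀ (i j : Fin n) → i ≢ j → ∀ a → toℕ (ident g i j a) ≡ 0)
      × TotSym t
      × (∀ (i j : Fin n) → i ≢ j → ∀ l → Essential (ident t i j) l ⇔ (l ≢ i × l ≢ j))))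
theorem4p9 (suc (suc k)) (suc (suc (suc n))) (s≤s (s≤s (s≤s _))) (s≤s (s≤s (s≤s (s≤s _)))) n≤k f =
  mk⇔ (split-from-InGminus n≤k)
      (λ (t , g , f≗t⊕g , _ , g-vanishes , _ , t-ess) → InGminus-from-split {f = f} {t} {g} f≗t⊕g g-vanishes t-ess)
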